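{- For any finite simple graph $G$ with vertex weight function $\omega : V(G) \to \mathbb{N}$, \[ \overline{X}_{(G,\omega)} = \sum_{C \in \mathsf{SSC}(G)} \overline{\widetilde{m}}_{\lambda(C)}. \]
   Context: $\mathbb{N}$ denotes the positive integers. For a finite simple graph $G$ and $\omega : V(G) \to \mathbb{N}$, a proper set coloring of $G$ is a map $\kappa$ assigning to each vertex $v$ a nonempty finite set $\kappa(v) \subseteq \mathbb{N}$ such that $\kappa(u) \cap \kappa(v) = \emptyset$ whenever $uv \in E(G)$. The vertex-weighted Kromatic symmetric function is $\overline{X}_{(G,\omega)} = \sum_{\kappa} \prod_{v \in V(G)} \big(\prod_{i \in \kappa(v)} x_i\big)^{\omega(v)}$, summed over all proper set colorings $\kappa$ of $G$. For an integer partition $\lambda = (\lambda_1 \ge \dots \ge \lambda_\ell)$, let $K_\lambda$ be the complete graph on vertex set $\{1,\dots,\ell\}$ with weight function $\omega(i) = \lambda_i$, and define the $K$-theoretic augmented monomial symmetric function $\overline{\widetilde{m}}_\lambda = \overline{X}_{K_\lambda}$. A stable set of $G$ is a set of pairwise non-adjacent vertices. A stable set cover of $G$ is a collection $C$ of distinct nonempty stable sets of $G$ whose union is $V(G)$ (the sets may overlap); $\mathsf{SSC}(G)$ denotes the family of all stable set covers. For $C \in \mathsf{SSC}(G)$, $\lambda(C)$ is the partition of length $|C|$ whose parts are the numbers $\sum_{v \in S} \omega(v)$ for $S \in C$. -}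

module Defs where

open import Data.Nat using (ℕ; zero; suc; _+_; _≡ᵇ_)
open import Data.Nat.Properties using (≤-decTotalOrder)
open import Data.Bool using (Bool; true; false; _∧_; _∨_; not; if_then_else_)
open import Data.Fin using (Fin; _≟_)
open import Data.Fin.Subset using (Subset)
open import Data.Vec using (Vec; []; _∷_)
import Data.Vec as V
open import Data.List using (List; []; _∷_; map; concatMap; length; allFin; reverse; _++_)
open import Data.Bool.ListAction using (all; any)
open import Data.Nat.ListAction using (sum)
import Data.List as L
open import Relation.Nullary using (yes; no)
open import Relation.Nullary.Decidable using (⌊_⌋)
open import Relation.Binary.PropositionalEquality using (_≡_; refl; sym)
open import Data.Empty using (⊥-elim)
open import Data.List.Sort ≤-decTotalOrder using (sort)

record SimpleGraph (n : ℕ) : Set where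
  field
    adj    : Fin n → Fin n → Bool
    adjSym : ∀ u v → adj u v ≡ adj v u
    adjIrr : ∀ v → adj v v ≡ false
open SimpleGraph public

private
  neqSym : ∀ {n} (u v : Fin n) → not ⌊ u ≟ v ⌋ ≡ not ⌊ v ≟ u ⌋
  neqSym u v with u ≟ v | v ≟ u
  ... | yes _ | yes _ = refl
  ... | no _  | no _  = refl
  ... | yes p | no q  = ⊥-elim (q (sym p))
  ... | no p  | yes q = ⊥-elim (p (sym q))

  neqIrr : ∀ {n} (v : Fin n) → not ⌊ v ≟ v ⌋ ≡ false
  neqIrr v with v ≟ v
  ... | yes _ = refl
  ... | no p  = ⊥-elim (p refl)

complete : (n : ℕ) → SimpleGraph n
complete n = record
  { adj = λ u v → not ⌊ u ≟ v ⌋ ; adjSym = neqSym ; adjIrr = neqIrr }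

count : ∀ {A : Set} → (A → Bool) → List A → ℕ
count p []       = 0
count p (x ∷ xs) = if p x then suc (count p xs) else count p xs

allVecs : ∀ {A : Set} → List A → (n : ℕ) → List (Vec A n)
allVecs xs zero    = [] ∷ []
allVecs xs (suc n) = concatMap (λ x → map (x ∷_) (allVecs xs n)) xs

allSubsets : (m : ℕ) → List (Subset m)
allSubsets m = allVecs (true ∷ false ∷ []) m

sublists : ∀ {A : Set} → List A → List (List A)
sublists []       = [] ∷ []
sublists (x ∷ xs) = sublists xs ++ map (x ∷_) (sublists xs)

nonemptyB : ∀ {m} → Subset m → Bool
nonemptyB {m} S = any (λ i → V.lookup S i) (allFin m)

disjointB : ∀ {m} → Subset m → Subset m → Bool
disjointB {m} S T = not (any (λ i → V.lookup S i ∧ V.lookup T i) (allFin m))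

-- A set coloring of G with colors from {1,…,m} (i.e. Fin m):
-- κ(v) ⊆ Fin m for every vertex v.
SetColoring : ℕ → ℕ → Set
SetColoring m n = Vec (Subset m) n

properB : ∀ {n m} → SimpleGraph n → SetColoring m n → Bool
properB {n} G κ =
  all (λ v → nonemptyB (V.lookup κ v)) (allFin n) ∧
  all (λ u → all (λ v → not (adj G u v) ∨ disjointB (V.lookup κ u) (V.lookup κ v))
                 (allFin n)) (allFin n)

-- Exponent of x_i in the monomial ∏_v (∏_{j ∈ κ(v)} x_j)^{ω(v)}.
exponentOf : ∀ {n m} → (Fin n → ℕ) → SetColoring m n → Fin m → ℕ
exponentOf {n} ω κ i = sum (map (λ v → if V.lookup (V.lookup κ v) i then ω v else 0) (allFin n))

monomialIsB : ∀ {n m} → (Fin n → ℕ) → (Fin m → ℕ) → SetColoring m n → Bool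
monomialIsB {n} {m} ω α κ = all (λ i → exponentOf ω κ i ≡ᵇ α i) (allFin m)

-- Coefficient of the monomial x_1^{α 1} ⋯ x_m^{α m} in \overline{X}_{(G,ω)}:
-- the number of proper set colorings κ whose monomial is x^α.
-- (With positive weights, such κ only use colors 1..m, so the count is finite
-- and enumerating κ : Fin n → Subset m is exhaustive.)
kromaticCoeff : ∀ {n m} → SimpleGraph n → (Fin n → ℕ) → (Fin m → ℕ) → ℕ
kromaticCoeff {n} {m} G ω α =
  count (λ κ → properB G κ ∧ monomialIsB ω α κ) (allVecs (allSubsets m) n)

-- Coefficient of x^α in \overline{\widetilde m}_λ = \overline{X}_{K_λ},
-- K_λ = complete graph on {1..ℓ(λ)} with ω(i) = λ_i.
augMonCoeff : ∀ {m} → List ℕ → (Fin m → ℕ) → ℕ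
augMonCoeff λs α = kromaticCoeff (complete (length λs)) (L.lookup λs) α

stableB : ∀ {n} → SimpleGraph n → Subset n → Bool
stableB {n} G S =
  all (λ u → all (λ v → not (V.lookup S u ∧ V.lookup S v ∧ adj G u v)) (allFin n)) (allFin n)

coversB : ∀ {n} → List (Subset n) → Bool
coversB {n} C = all (λ v → any (λ S → V.lookup S v) C) (allFin n)

isSSCB : ∀ {n} → SimpleGraph n → List (Subset n) → Bool
isSSCB G C = all (λ S → nonemptyB S ∧ stableB G S) C ∧ coversB C

-- SSC(G): all collections of distinct nonempty stable sets covering V(G),
-- each collection listed exactly once (as a sublist of the repetition-free
-- list of all subsets).
SSC : ∀ {n} → SimpleGraph n → List (List (Subset n))
SSC {n} G = L.filterᵇ (isSSCB G) (sublists (allSubsets n))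

weightOf : ∀ {n} → (Fin n → ℕ) → Subset n → ℕ
weightOf {n} ω S = sum (map (λ v → if V.lookup S v then ω v else 0) (allFin n))

partitionOf : ∀ {n} → (Fin n → ℕ) → List (Subset n) → List ℕ
partitionOf ω C = reverse (sort (map (weightOf ω) C))

-- A set coloring κ is determined by its color classes {v | i ∈ κ(v)}; κ is proper exactly when
-- the classes are stable and cover the vertices, and the exponent of x_i in its monomial is the
-- weight of the i-th class.  So the nonempty classes of a proper κ form a stable set cover
-- C ∈ SSC(G), and sorting the colorings by C splits the coefficient into a sum over SSC(G).
-- Write C as blocks c_1, …, c_ℓ in the order of λ(C).  The colorings with cover C correspond to
-- the proper set colorings τ of K_λ(C): block j receives the colors whose class is c_j, so the
-- i-th class of τ is ∅ or {j} exactly when that of κ is ∅ or c_j.  Matched classes have the same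
-- weight, λ(C)_j = ω(c_j), so the correspondence preserves monomials, and the colorings with
-- cover C are counted by the coefficient of the augmented monomial m̃_λ(C).
module Submission where

open import Defs
open import Data.Bool using (Bool; true; false; T; not; _∧_; _∨_; if_then_else_)
import Data.Bool as Bool
open import Data.Bool.Properties using (T-∧; T-≡)
open import Data.Bool.ListAction using (and; all; any)
open import Data.Nat using (ℕ; zero; suc; _+_; _≤_; z≤n; s≤s; _≡ᵇ_)
open import Data.Nat.Properties using (+-commutativeSemigroup; +-identityʳ; ≤-trans; m≤n+m; ≤-refl; ≤-decTotalOrder)
open import Data.Nat.ListAction using (sum)
open import Algebra.Properties.CommutativeSemigroup +-commutativeSemigroup using (interchange)
open import Data.Fin using (Fin; zero; suc)
import Data.Fin as Fin
import Data.Fin.Permutation as Permutation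
open import Data.Fin.Subset using (Subset; ⊥; ⁅_⁆; Nonempty) renaming (_∈_ to _∈ₛ_)
open import Data.Fin.Subset.Properties
  using (∉⊥; ⊥⊆; x∈⁅x⁆; x∈⁅y⁆⇒x≡y; ⊆-antisym; nonempty?; Empty-unique)
open import Data.Vec using (Vec; []; _∷_; lookup; tabulate)
import Data.Vec.Properties as VP
open import Data.List using (List; []; _∷_; map; concatMap; _++_; length; allFin)
import Data.List as L
import Data.List.Properties as LP
open import Data.List.Membership.Propositional using (_∈_; _∉_; find; lose)
open import Data.List.Membership.Propositional.Properties
  using (∈-++⁻; ∈-++⁺ˡ; ∈-++⁺ʳ; ∈-map⁻; ∈-map⁺; ∈-filter⁺; ∈-filter⁻)
open import Data.List.Relation.Unary.Any using (here; there)
import Data.List.Relation.Unary.All as All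
import Data.List.Relation.Unary.All.Properties as All
import Data.List.Relation.Unary.Any.Properties as Any
open import Data.List.Relation.Binary.Permutation.Propositional using (_↭_; ↭-trans; ↭⇒↭ₛ)
open import Data.List.Relation.Binary.Permutation.Propositional.Properties using (↭-reverse)
import Data.List.Relation.Binary.Permutation.Setoid as Permₛ
import Data.List.Relation.Binary.Permutation.Setoid.Properties as Permₛ
open import Data.List.Sort ≤-decTotalOrder using (sort; sort-↭)
open import Data.Product using (∃; _×_; _,_; proj₁; proj₂)
open import Data.Sum using (_⊎_; inj₁; inj₂)
open import Data.Empty using (⊥-elim)
open import Function using (_∘_; _⇔_; mk⇔; Equivalence; Inverse)
open import Relation.Nullary using (¬_; Dec; yes; no)
open import Relation.Nullary.Decidable using (⌊_⌋; T?; toWitness; fromWitness)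
open import Relation.Binary.Definitions using (DecidableEquality)
open import Relation.Binary.PropositionalEquality
  using (_≡_; _≢_; refl; sym; trans; cong; cong₂; subst; setoid; module ≡-Reasoning)
open ≡-Reasoning
open Equivalence using (to; from)

private variable
  A B X : Set
  n m ℓ a b : ℕ

-- Counting in lists

T-ext : {x y : Bool} → (T x → T y) → (T y → T x) → x ≡ y
T-ext {false} {false} _ _ = refl
T-ext {false} {true}  _ g = ⊥-elim (g _)
T-ext {true}  {false} f _ = ⊥-elim (f _)
T-ext {true}  {true}  _ _ = refl

⌊⌋-⇔ : ∀ {P Q : Set} (p? : Dec P) (q? : Dec Q) → P ⇔ Q → ⌊ p? ⌋ ≡ ⌊ q? ⌋
⌊⌋-⇔ _ _ P⇔Q = T-ext (fromWitness ∘ to P⇔Q ∘ toWitness) (fromWitness ∘ from P⇔Q ∘ toWitness)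

∑ : List A → (A → ℕ) → ℕ
∑ xs h = sum (map h xs)

syntax ∑ xs (λ x → e) = ∑[ x ← xs ] e

∑-cong : ∀ (xs : List A) {h k : A → ℕ} → (∀ {x} → x ∈ xs → h x ≡ k x) → ∑ xs h ≡ ∑ xs k
∑-cong []       _ = refl
∑-cong (x ∷ xs) e = cong₂ _+_ (e (here refl)) (∑-cong xs (e ∘ there))

∑-zero : ∀ (xs : List A) → ∑[ x ← xs ] 0 ≡ 0
∑-zero []       = refl
∑-zero (_ ∷ xs) = ∑-zero xs

∑-+ : ∀ (xs : List A) (h k : A → ℕ) → ∑[ x ← xs ] (h x + k x) ≡ ∑ xs h + ∑ xs k
∑-+ []       h k = refl
∑-+ (x ∷ xs) h k = begin
  h x + k x + ∑[ y ← xs ] (h y + k y)  ≡⟨ cong (h x + k x +_) (∑-+ xs h k) ⟩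
  h x + k x + (∑ xs h + ∑ xs k)        ≡⟨ interchange (h x) (k x) (∑ xs h) (∑ xs k) ⟩
  h x + ∑ xs h + (k x + ∑ xs k)        ∎

∑-comm : ∀ (xs : List A) (ys : List B) (h : A → B → ℕ) →
         ∑[ y ← ys ] ∑[ x ← xs ] h x y ≡ ∑[ x ← xs ] ∑[ y ← ys ] h x y
∑-comm xs []       h = sym (∑-zero xs)
∑-comm xs (y ∷ ys) h = begin
  ∑[ x ← xs ] h x y + ∑[ y′ ← ys ] ∑[ x ← xs ] h x y′
    ≡⟨ cong (∑[ x ← xs ] h x y +_) (∑-comm xs ys h) ⟩
  ∑[ x ← xs ] h x y + ∑[ x ← xs ] ∑[ y′ ← ys ] h x y′
    ≡⟨ sym (∑-+ xs (λ x → h x y) (λ x → ∑[ y′ ← ys ] h x y′)) ⟩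
  ∑[ x ← xs ] (h x y + ∑[ y′ ← ys ] h x y′)
    ∎

indicator : Bool → ℕ
indicator b = if b then 1 else 0

count≡∑ : ∀ (p : A → Bool) xs → count p xs ≡ ∑[ x ← xs ] indicator (p x)
count≡∑ p []       = refl
count≡∑ p (x ∷ xs) with p x
... | true  = cong suc (count≡∑ p xs)
... | false = count≡∑ p xs

count-cong : ∀ {p q : A → Bool} xs → (∀ x → p x ≡ q x) → count p xs ≡ count q xs
count-cong {p = p} {q} xs e = begin
  count p xs                       ≡⟨ count≡∑ p xs ⟩
  ∑[ x ← xs ] indicator (p x)     ≡⟨ ∑-cong xs (λ {x} _ → cong indicator (e x)) ⟩
  ∑[ x ← xs ] indicator (q x)     ≡⟨ sym (count≡∑ q xs) ⟩
  count q xs                       ∎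

count-map : ∀ (p : B → Bool) (f : A → B) xs → count p (map f xs) ≡ count (p ∘ f) xs
count-map p f []       = refl
count-map p f (x ∷ xs) with p (f x)
... | true  = cong suc (count-map p f xs)
... | false = count-map p f xs

count-++ : ∀ (p : A → Bool) xs ys → count p (xs ++ ys) ≡ count p xs + count p ys
count-++ p []       ys = refl
count-++ p (x ∷ xs) ys with p x
... | true  = cong suc (count-++ p xs ys)
... | false = count-++ p xs ys

count-concatMap : ∀ (p : B → Bool) (f : A → List B) xs →
                  count p (concatMap f xs) ≡ ∑[ x ← xs ] count p (f x)
count-concatMap p f []       = refl
count-concatMap p f (x ∷ xs) =
  trans (count-++ p (f x) (concatMap f xs)) (cong (count p (f x) +_) (count-concatMap p f xs))

count-filterᵇ : ∀ (q r : A → Bool) xs → count r (L.filterᵇ q xs) ≡ count (λ x → q x ∧ r x) xs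
count-filterᵇ q r []       = refl
count-filterᵇ q r (x ∷ xs) with q x
... | false = count-filterᵇ q r xs
... | true with r x
...   | true  = cong suc (count-filterᵇ q r xs)
...   | false = count-filterᵇ q r xs

count-none : ∀ (p : A → Bool) xs → (∀ {x} → x ∈ xs → ¬ T (p x)) → count p xs ≡ 0
count-none p []       _ = refl
count-none p (x ∷ xs) h with p x | h (here refl)
... | true  | ¬px = ⊥-elim (¬px _)
... | false | _   = count-none p xs (h ∘ there)

count-witness : ∀ (p : A → Bool) xs → 1 ≤ count p xs → ∃ λ x → x ∈ xs × T (p x)
count-witness p (x ∷ xs) le with p x in px
... | true  = x , here refl , subst T (sym px) _
... | false with count-witness p xs le
...   | y , y∈ , py = y , there y∈ , py

module _ (_≟_ : DecidableEquality A) where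

  multiplicity : A → List A → ℕ
  multiplicity a = count (λ b → ⌊ a ≟ b ⌋)

  record IsEnumeration (xs : List A) : Set where
    constructor enumeration
    field once : ∀ a → multiplicity a xs ≡ 1

  open IsEnumeration public

  record Distinct (xs : List A) : Set where
    constructor distinct
    field at-most-once : ∀ a → multiplicity a xs ≤ 1

  enumeration-∈ : ∀ {xs} → IsEnumeration xs → ∀ a → a ∈ xs
  enumeration-∈ {xs} (enumeration once) a with count-witness _ xs (subst (1 ≤_) (sym (once a)) ≤-refl)
  ... | b , b∈ , a≡b = subst (_∈ xs) (sym (toWitness a≡b)) b∈

  multiplicity-∉ : ∀ {a xs} → a ∉ xs → multiplicity a xs ≡ 0
  multiplicity-∉ {a} {xs} a∉ = count-none _ xs (λ b∈ t → a∉ (subst (_∈ xs) (sym (toWitness t)) b∈))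

  enumeration⇒distinct : ∀ {xs} → IsEnumeration xs → Distinct xs
  enumeration⇒distinct (enumeration once) = distinct λ a → subst (_≤ 1) (sym (once a)) ≤-refl

  multiplicity-∈ : ∀ {a xs} → a ∈ xs → 1 ≤ multiplicity a xs
  multiplicity-∈ {a} {x ∷ xs} (here refl) with a ≟ a
  ... | yes _  = s≤s z≤n
  ... | no a≢a = ⊥-elim (a≢a refl)
  multiplicity-∈ {a} {x ∷ xs} (there a∈) with a ≟ x
  ... | yes _ = s≤s z≤n
  ... | no _  = multiplicity-∈ a∈

  distinct-head : ∀ {x xs} → Distinct (x ∷ xs) → x ∉ xs
  distinct-head {x} {xs} (distinct d) x∈ with x ≟ x | d x
  ... | no x≢x | _      = x≢x refl
  ... | yes _  | s≤s le with ≤-trans (multiplicity-∈ {x} {xs} x∈) le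
  ...   | ()

  distinct-tail : ∀ {x xs} → Distinct (x ∷ xs) → Distinct xs
  distinct-tail {x} {xs} (distinct d) = distinct tail
    where
    tail : ∀ a → multiplicity a xs ≤ 1
    tail a with a ≟ x | d a
    ... | yes _ | le = ≤-trans (m≤n+m _ 1) le
    ... | no _  | le = le

  count-fibres : ∀ (φ : X → A) (p : X → Bool) (xs : List X) zs →
                 (∀ x → T (p x) → multiplicity (φ x) zs ≡ 1) →
                 count p xs ≡ ∑[ z ← zs ] count (λ x → p x ∧ ⌊ φ x ≟ z ⌋) xs
  count-fibres φ p xs zs once = begin
    count p xs                                             ≡⟨ count≡∑ p xs ⟩
    ∑[ x ← xs ] indicator (p x)                           ≡⟨ ∑-cong xs (λ {x} _ → split x) ⟩
    ∑[ x ← xs ] ∑[ z ← zs ] indicator (p x ∧ ⌊ φ x ≟ z ⌋) ≡⟨ sym (∑-comm xs zs _) ⟩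
    ∑[ z ← zs ] ∑[ x ← xs ] indicator (p x ∧ ⌊ φ x ≟ z ⌋) ≡⟨ ∑-cong zs (λ {z} _ → sym (count≡∑ _ xs)) ⟩
    ∑[ z ← zs ] count (λ x → p x ∧ ⌊ φ x ≟ z ⌋) xs        ∎
    where
    split : ∀ x → indicator (p x) ≡ ∑[ z ← zs ] indicator (p x ∧ ⌊ φ x ≟ z ⌋)
    split x with p x in px
    ... | true  = sym (trans (sym (count≡∑ _ zs)) (once x (subst T (sym px) _)))
    ... | false = sym (∑-zero zs)

module _ {_≟A_ : DecidableEquality A} {_≟B_ : DecidableEquality B}
         {xs : List A} {ys : List B} (xs-enum : IsEnumeration _≟A_ xs) (ys-enum : IsEnumeration _≟B_ ys)
         {p : A → Bool} {q : B → Bool} (f : A → B) (g : B → A)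
         (f-pres : ∀ a → T (p a) → T (q (f a))) (g-pres : ∀ b → T (q b) → T (p (g b)))
         (g∘f : ∀ a → T (p a) → g (f a) ≡ a) (f∘g : ∀ b → T (q b) → f (g b) ≡ b) where

  count-bijection : count p xs ≡ count q ys
  count-bijection = begin
    count p xs                                       ≡⟨ count-fibres _≟B_ f p xs ys (λ a _ → once ys-enum (f a)) ⟩
    ∑[ b ← ys ] count (λ a → p a ∧ ⌊ f a ≟B b ⌋) xs ≡⟨ ∑-cong ys (λ {b} _ → fibre b) ⟩
    ∑[ b ← ys ] indicator (q b)                     ≡⟨ sym (count≡∑ q ys) ⟩
    count q ys                                       ∎
    where
    fibre : ∀ b → count (λ a → p a ∧ ⌊ f a ≟B b ⌋) xs ≡ indicator (q b)
    fibre b with q b in qb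
    ... | true  = trans (count-cong xs (λ a → T-ext (fibre⇒ a) (⇒fibre a))) (once xs-enum (g b))
      where
      qb′ : T (q b)
      qb′ = subst T (sym qb) _
      fibre⇒ : ∀ a → T (p a ∧ ⌊ f a ≟B b ⌋) → T ⌊ g b ≟A a ⌋
      fibre⇒ a t with to T-∧ t
      ... | pa , fa≡b = fromWitness (trans (cong g (sym (toWitness fa≡b))) (g∘f a pa))
      ⇒fibre : ∀ a → T ⌊ g b ≟A a ⌋ → T (p a ∧ ⌊ f a ≟B b ⌋)
      ⇒fibre a t with toWitness t
      ... | refl = from T-∧ (g-pres b qb′ , fromWitness (f∘g b qb′))
    ... | false = count-none _ xs none
      where
      none : ∀ {a} → a ∈ xs → ¬ T (p a ∧ ⌊ f a ≟B b ⌋)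
      none {a} _ t with to T-∧ t
      ... | pa , fa≡b = subst T (trans (cong q (toWitness fa≡b)) qb) (f-pres a pa)

module _ {_≟_ : DecidableEquality A} {xs : List A} (xs-enum : IsEnumeration _≟_ xs) where

  allVecs-once : ∀ n (bs : Vec A n) → multiplicity (VP.≡-dec _≟_) bs (allVecs xs n) ≡ 1
  allVecs-once zero    []       = refl
  allVecs-once (suc n) (b ∷ bs) = begin
    count (λ v → ⌊ VP.≡-dec _≟_ (b ∷ bs) v ⌋) (concatMap (λ x → map (x ∷_) (allVecs xs n)) xs)
      ≡⟨ count-concatMap _ _ xs ⟩
    ∑[ x ← xs ] count (λ v → ⌊ VP.≡-dec _≟_ (b ∷ bs) v ⌋) (map (x ∷_) (allVecs xs n))
      ≡⟨ ∑-cong xs (λ {x} _ → trans (count-map _ (x ∷_) (allVecs xs n)) (headed x)) ⟩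
    ∑[ x ← xs ] indicator ⌊ b ≟ x ⌋
      ≡⟨ sym (count≡∑ _ xs) ⟩
    multiplicity _≟_ b xs
      ≡⟨ once xs-enum b ⟩
    1 ∎
    where
    headed : ∀ x → count (λ v → ⌊ VP.≡-dec _≟_ (b ∷ bs) (x ∷ v) ⌋) (allVecs xs n)
                   ≡ indicator ⌊ b ≟ x ⌋
    headed x with b ≟ x
    ... | yes refl = trans (count-cong (allVecs xs n) λ v →
                              ⌊⌋-⇔ _ (VP.≡-dec _≟_ bs v) (mk⇔ VP.∷-injectiveʳ (cong (x ∷_))))
                           (allVecs-once n bs)
    ... | no _     = count-none _ (allVecs xs n) (λ _ ())

  allVecs-enumeration : ∀ n → IsEnumeration (VP.≡-dec _≟_) (allVecs xs n)
  allVecs-enumeration n = enumeration (allVecs-once n)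

-- Sublists

∈-sublists⁻ : ∀ {x : A} {xs ys} → ys ∈ sublists (x ∷ xs) →
              ys ∈ sublists xs ⊎ ∃ λ zs → zs ∈ sublists xs × ys ≡ x ∷ zs
∈-sublists⁻ {xs = xs} ys∈ with ∈-++⁻ (sublists xs) ys∈
... | inj₁ ys∈′ = inj₁ ys∈′
... | inj₂ ys∈′ = inj₂ (∈-map⁻ _ ys∈′)

sublists-⊆ : ∀ (xs : List A) {ys y} → ys ∈ sublists xs → y ∈ ys → y ∈ xs
sublists-⊆ []       (here refl) ()
sublists-⊆ (x ∷ xs) ys∈ y∈ with ∈-sublists⁻ {x = x} {xs} ys∈
... | inj₁ ys∈′                      = there (sublists-⊆ xs ys∈′ y∈)
... | inj₂ (zs , zs∈ , refl) with y∈
...   | here refl = here refl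
...   | there y∈′ = there (sublists-⊆ xs zs∈ y∈′)

filterᵇ-∈-sublists : ∀ (q : A → Bool) xs → L.filterᵇ q xs ∈ sublists xs
filterᵇ-∈-sublists q []       = here refl
filterᵇ-∈-sublists q (x ∷ xs) with q x
... | true  = ∈-++⁺ʳ (sublists xs) (∈-map⁺ (x ∷_) (filterᵇ-∈-sublists q xs))
... | false = ∈-++⁺ˡ (filterᵇ-∈-sublists q xs)

module _ {_≟_ : DecidableEquality A} where

  private
    _≟L_ : DecidableEquality (List A)
    _≟L_ = LP.≡-dec _≟_

  count-sublists-≤ : ∀ (p : A → Bool) xs {ys} → ys ∈ sublists xs → count p ys ≤ count p xs
  count-sublists-≤ p []       (here refl) = z≤n
  count-sublists-≤ p (x ∷ xs) ys∈ with ∈-sublists⁻ {x = x} {xs} ys∈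
  ... | inj₁ ys∈′ with p x
  ...   | true  = ≤-trans (count-sublists-≤ p xs ys∈′) (m≤n+m _ 1)
  ...   | false = count-sublists-≤ p xs ys∈′
  count-sublists-≤ p (x ∷ xs) ys∈ | inj₂ (zs , zs∈ , refl) with p x
  ...   | true  = s≤s (count-sublists-≤ p xs zs∈)
  ...   | false = count-sublists-≤ p xs zs∈

  distinct-sublist : ∀ {xs ys} → Distinct _≟_ xs → ys ∈ sublists xs → Distinct _≟_ ys
  distinct-sublist {xs} (distinct d) ys∈ = distinct λ a → ≤-trans (count-sublists-≤ _ xs ys∈) (d a)

  sublists-once : ∀ {xs ys} → Distinct _≟_ xs → ys ∈ sublists xs → multiplicity _≟L_ ys (sublists xs) ≡ 1
  sublists-once {[]}     _ (here refl) = refl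
  sublists-once {x ∷ xs} {ys} d ys∈ with ∈-sublists⁻ {x = x} {xs} ys∈
  ... | inj₁ ys∈′ = begin
    multiplicity _≟L_ ys (sublists xs ++ map (x ∷_) (sublists xs))
      ≡⟨ count-++ _ (sublists xs) _ ⟩
    multiplicity _≟L_ ys (sublists xs) + multiplicity _≟L_ ys (map (x ∷_) (sublists xs))
      ≡⟨ cong₂ _+_ (sublists-once (distinct-tail _≟_ d) ys∈′) (multiplicity-∉ _≟L_ not-headed) ⟩
    1 ∎
    where
    not-headed : ys ∉ map (x ∷_) (sublists xs)
    not-headed ys∈″ with ∈-map⁻ _ ys∈″
    ... | zs , _ , refl = distinct-head _≟_ d (sublists-⊆ xs ys∈′ (here refl))
  ... | inj₂ (zs , zs∈ , refl) = begin
    multiplicity _≟L_ (x ∷ zs) (sublists xs ++ map (x ∷_) (sublists xs))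
      ≡⟨ count-++ _ (sublists xs) _ ⟩
    multiplicity _≟L_ (x ∷ zs) (sublists xs) + multiplicity _≟L_ (x ∷ zs) (map (x ∷_) (sublists xs))
      ≡⟨ cong₂ _+_ (multiplicity-∉ _≟L_ λ x∷zs∈ → distinct-head _≟_ d (sublists-⊆ xs x∷zs∈ (here refl)))
                   (count-map _ (x ∷_) (sublists xs)) ⟩
    count (λ ws → ⌊ (x ∷ zs) ≟L (x ∷ ws) ⌋) (sublists xs)
      ≡⟨ count-cong (sublists xs) (λ ws → ⌊⌋-⇔ _ (zs ≟L ws) (mk⇔ LP.∷-injectiveʳ (cong (x ∷_)))) ⟩
    multiplicity _≟L_ zs (sublists xs)
      ≡⟨ sublists-once (distinct-tail _≟_ d) zs∈ ⟩
    1 ∎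

  filterᵇ-≡-sublist : ∀ (q : A → Bool) {xs ys} → Distinct _≟_ xs → ys ∈ sublists xs →
                      (∀ {x} → x ∈ xs → T (q x) → x ∈ ys) → (∀ {y} → y ∈ ys → T (q y)) →
                      L.filterᵇ q xs ≡ ys
  filterᵇ-≡-sublist q {[]} _ (here refl) _ _ = refl
  filterᵇ-≡-sublist q {x ∷ xs} d ys∈ kept only with ∈-sublists⁻ {x = x} {xs} ys∈
  ... | inj₁ ys∈′ with q x in qx
  ...   | true  = ⊥-elim (distinct-head _≟_ d (sublists-⊆ xs ys∈′ (kept (here refl) (subst T (sym qx) _))))
  ...   | false = filterᵇ-≡-sublist q (distinct-tail _≟_ d) ys∈′ (kept ∘ there) only
  filterᵇ-≡-sublist q {x ∷ xs} d ys∈ kept only | inj₂ (zs , zs∈ , refl) with q x | only (here refl)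
  ... | true  | _ = cong (x ∷_) (filterᵇ-≡-sublist q (distinct-tail _≟_ d) zs∈ kept′ (only ∘ there))
    where
    kept′ : ∀ {z} → z ∈ xs → T (q z) → z ∈ zs
    kept′ z∈ qz with kept (there z∈) qz
    ... | here refl = ⊥-elim (distinct-head _≟_ d z∈)
    ... | there z∈′ = z∈′

-- Subsets, color classes and the Boolean definitions

T-not⇔¬ : ∀ {b} → T (not b) ⇔ (¬ T b)
T-not⇔¬ {false} = mk⇔ (λ _ ()) (λ _ → _)
T-not⇔¬ {true}  = mk⇔ (λ ()) (λ ¬t → ¬t _)

T-not-∨⇔ : ∀ {a b} → T (not a ∨ b) ⇔ (T a → T b)
T-not-∨⇔ {false} = mk⇔ (λ _ ()) (λ _ → _)
T-not-∨⇔ {true}  = mk⇔ (λ b _ → b) (λ f → f _)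

T-all-allFin : ∀ (p : Fin n → Bool) → T (all p (allFin n)) ⇔ (∀ i → T (p i))
T-all-allFin p = mk⇔ (All.tabulate⁻ ∘ All.all⁺ p _) (All.all⁻ p ∘ All.tabulate⁺)

T-any-allFin : ∀ (p : Fin n → Bool) → T (any p (allFin n)) ⇔ ∃ λ i → T (p i)
T-any-allFin p = mk⇔ (Any.tabulate⁻ ∘ Any.any⁻ p _) (λ (i , pi) → Any.any⁺ p (Any.tabulate⁺ i pi))

∈ₛ⇔T : ∀ {i : Fin n} {S} → i ∈ₛ S ⇔ T (lookup S i)
∈ₛ⇔T {i = i} {S} = mk⇔ (from T-≡ ∘ VP.[]=⇒lookup) (VP.lookup⇒[]= i S ∘ to T-≡)

∈-tabulate⇔ : ∀ {f : Fin n → Bool} {i} → i ∈ₛ tabulate f ⇔ T (f i)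
∈-tabulate⇔ {f = f} {i} = mk⇔ (subst T (VP.lookup∘tabulate f i) ∘ to ∈ₛ⇔T)
                               (from ∈ₛ⇔T ∘ subst T (sym (VP.lookup∘tabulate f i)))

nonemptyB⇔ : ∀ {S : Subset n} → T (nonemptyB S) ⇔ Nonempty S
nonemptyB⇔ {S = S} = mk⇔ (λ t → let i , i∈ = to (T-any-allFin (lookup S)) t in i , from ∈ₛ⇔T i∈)
                         (λ (i , i∈) → from (T-any-allFin (lookup S)) (i , to ∈ₛ⇔T i∈))

disjointB⇔ : ∀ {S S′ : Subset n} → T (disjointB S S′) ⇔ (∀ i → i ∈ₛ S → ¬ i ∈ₛ S′)
disjointB⇔ {n = n} {S = S} {S′} = mk⇔
  (λ t _ i∈S i∈S′ → to T-not⇔¬ t (from (T-any-allFin both) (_ , from T-∧ (to ∈ₛ⇔T i∈S , to ∈ₛ⇔T i∈S′))))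
  (λ h → from T-not⇔¬ (common h ∘ to (T-any-allFin both)))
  where
  both : Fin n → Bool
  both i = lookup S i ∧ lookup S′ i
  common : (∀ i → i ∈ₛ S → ¬ i ∈ₛ S′) → ¬ ∃ λ i → T (lookup S i ∧ lookup S′ i)
  common h (i , t) with to T-∧ t
  ... | i∈S , i∈S′ = h i (from ∈ₛ⇔T i∈S) (from ∈ₛ⇔T i∈S′)

Stable : SimpleGraph n → Subset n → Set
Stable G S = ∀ {u v} → u ∈ₛ S → v ∈ₛ S → ¬ T (adj G u v)

stableB⇔ : ∀ {G : SimpleGraph n} {S} → T (stableB G S) ⇔ Stable G S
stableB⇔ {n = n} {G = G} {S} = mk⇔
  (λ t {u} {v} u∈ v∈ a → to T-not⇔¬ (to (T-all-allFin (row u)) (to (T-all-allFin rows) t u) v)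
                                     (from T-∧ (to ∈ₛ⇔T u∈ , from T-∧ (to ∈ₛ⇔T v∈ , a))))
  (λ h → from (T-all-allFin rows) λ u → from (T-all-allFin (row u)) λ v →
           from T-not⇔¬ (not-adjacent (λ {u} {v} → h {u} {v})))
  where
  row : Fin n → Fin n → Bool
  row u v = not (lookup S u ∧ lookup S v ∧ adj G u v)
  rows : Fin n → Bool
  rows u = all (row u) (allFin n)
  not-adjacent : Stable G S → ∀ {u v} → ¬ T (lookup S u ∧ lookup S v ∧ adj G u v)
  not-adjacent h t with to T-∧ t
  ... | u∈ , rest with to T-∧ rest
  ...   | v∈ , a = h (from ∈ₛ⇔T u∈) (from ∈ₛ⇔T v∈) a

classOf : SetColoring m n → Fin m → Subset n
classOf κ i = tabulate (λ v → lookup (lookup κ v) i)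

∈-classOf⇔ : ∀ {κ : SetColoring m n} {i v} → v ∈ₛ classOf κ i ⇔ i ∈ₛ lookup κ v
∈-classOf⇔ = mk⇔ (from ∈ₛ⇔T ∘ to ∈-tabulate⇔) (from ∈-tabulate⇔ ∘ to ∈ₛ⇔T)

record IsProperColoring (G : SimpleGraph n) (κ : SetColoring m n) : Set where
  field
    colored       : ∀ v → ∃ λ i → v ∈ₛ classOf κ i
    stableClasses : ∀ i → Stable G (classOf κ i)

properB⇔ : ∀ {G : SimpleGraph n} {κ : SetColoring m n} → T (properB G κ) ⇔ IsProperColoring G κ
properB⇔ {n = n} {G = G} {κ} = mk⇔ sound complete′
  where
  ∈classOf : ∀ {i v} → v ∈ₛ classOf κ i ⇔ i ∈ₛ lookup κ v
  ∈classOf = ∈-classOf⇔ {κ = κ}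

  colored? : Fin n → Bool
  colored? v = nonemptyB (lookup κ v)

  separated? : Fin n → Fin n → Bool
  separated? u v = not (adj G u v) ∨ disjointB (lookup κ u) (lookup κ v)

  separated⇔ : ∀ {u v} → T (separated? u v) ⇔
                          (T (adj G u v) → ∀ i → i ∈ₛ lookup κ u → ¬ i ∈ₛ lookup κ v)
  separated⇔ {u} {v} = mk⇔
    (λ t a → to disjoint⇔ (to T-not-∨⇔ t a))
    (λ h → from T-not-∨⇔ (from disjoint⇔ ∘ h))
    where disjoint⇔ = disjointB⇔ {S = lookup κ u} {lookup κ v}

  everywhere⇔ : ((∀ v → T (colored? v)) × (∀ u v → T (separated? u v))) ⇔ T (properB G κ)
  everywhere⇔ = mk⇔
    (λ (c , s) → from T-∧ ( from (T-all-allFin colored?) c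
                          , from (T-all-allFin rows) λ u → from (T-all-allFin (separated? u)) (s u)))
    (λ t → let c , s = to T-∧ t
           in to (T-all-allFin colored?) c , λ u → to (T-all-allFin (separated? u)) (to (T-all-allFin rows) s u))
    where
    rows : Fin n → Bool
    rows u = all (separated? u) (allFin n)

  sound : T (properB G κ) → IsProperColoring G κ
  sound t = record
    { colored       = λ v → let i , i∈ = to nonemptyB⇔ (c v) in i , from ∈classOf i∈
    ; stableClasses = λ i {u} {v} u∈ v∈ a → to separated⇔ (s u v) a i (to ∈classOf u∈) (to ∈classOf v∈)
    }
    where
    c = proj₁ (from everywhere⇔ t)
    s = proj₂ (from everywhere⇔ t)

  complete′ : IsProperColoring G κ → T (properB G κ)
  complete′ p = to everywhere⇔
    ( (λ v → let i , v∈ = colored v in from nonemptyB⇔ (i , to ∈classOf v∈))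
    , (λ u v → from separated⇔ λ a i i∈u i∈v →
                   stableClasses i (from ∈classOf i∈u) (from ∈classOf i∈v) a))
    where open IsProperColoring p

record IsStableSetCover (G : SimpleGraph n) (C : List (Subset n)) : Set where
  field
    nonempty : ∀ {S} → S ∈ C → Nonempty S
    stable   : ∀ {S} → S ∈ C → Stable G S
    covers   : ∀ v → ∃ λ S → S ∈ C × v ∈ₛ S

isSSCB⇔ : ∀ {G : SimpleGraph n} {C} → T (isSSCB G C) ⇔ IsStableSetCover G C
isSSCB⇔ {n = n} {G = G} {C} = mk⇔ sound complete′
  where
  good? : Subset n → Bool
  good? S = nonemptyB S ∧ stableB G S

  covered? : Fin n → Bool
  covered? v = any (λ S → lookup S v) C

  sound : T (isSSCB G C) → IsStableSetCover G C
  sound t = record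
    { nonempty = λ S∈ → to nonemptyB⇔ (proj₁ (to T-∧ (good S∈)))
    ; stable   = λ S∈ → to (stableB⇔ {G = G}) (proj₂ (to T-∧ (good S∈)))
    ; covers   = λ v → let S , S∈ , v∈ = find (Any.any⁻ _ C (to (T-all-allFin covered?) (proj₂ (to T-∧ t)) v))
                       in S , S∈ , from ∈ₛ⇔T v∈
    }
    where
    good : ∀ {S} → S ∈ C → T (good? S)
    good = All.lookup (All.all⁺ good? C (proj₁ (to T-∧ t)))

  complete′ : IsStableSetCover G C → T (isSSCB G C)
  complete′ ssc = from T-∧
    ( All.all⁻ good? (All.tabulate λ S∈ →
        from T-∧ (from nonemptyB⇔ (nonempty S∈) , from (stableB⇔ {G = G}) (stable S∈)))
    , from (T-all-allFin covered?) λ v →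
        let S , S∈ , v∈ = covers v in Any.any⁺ _ (lose S∈ (to ∈ₛ⇔T v∈)))
    where open IsStableSetCover ssc

exponentOf≡weightOf : ∀ (ω : Fin n → ℕ) (κ : SetColoring m n) i →
                      exponentOf ω κ i ≡ weightOf ω (classOf κ i)
exponentOf≡weightOf {n = n} ω κ i =
  cong sum (LP.map-cong (λ v → cong (λ b → if b then ω v else 0) (sym (VP.lookup∘tabulate _ v))) (allFin n))

weightOf-∷ : ∀ (ω : Fin (suc n) → ℕ) b S →
             weightOf ω (b ∷ S) ≡ (if b then ω zero else 0) + weightOf (ω ∘ suc) S
weightOf-∷ {n = n} ω b S = cong ((if b then ω zero else 0) +_) (cong sum (begin
  map summand (L.tabulate suc)    ≡⟨ LP.map-tabulate suc summand ⟩
  L.tabulate (summand ∘ suc)      ≡⟨ sym (LP.map-tabulate (λ v → v) (summand ∘ suc)) ⟩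
  map (summand ∘ suc) (allFin n)  ∎))
  where
  summand : Fin (suc n) → ℕ
  summand v = if lookup (b ∷ S) v then ω v else 0

weightOf-⊥ : ∀ (ω : Fin n → ℕ) → weightOf ω ⊥ ≡ 0
weightOf-⊥ {n = zero}  ω = refl
weightOf-⊥ {n = suc n} ω = trans (weightOf-∷ ω false ⊥) (weightOf-⊥ (ω ∘ suc))

weightOf-⁅⁆ : ∀ (ω : Fin n → ℕ) j → weightOf ω ⁅ j ⁆ ≡ ω j
weightOf-⁅⁆ ω zero    = begin
  weightOf ω ⁅ zero ⁆          ≡⟨ weightOf-∷ ω true ⊥ ⟩
  ω zero + weightOf (ω ∘ suc) ⊥ ≡⟨ cong (ω zero +_) (weightOf-⊥ (ω ∘ suc)) ⟩
  ω zero + 0                   ≡⟨ +-identityʳ (ω zero) ⟩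
  ω zero                       ∎
weightOf-⁅⁆ ω (suc j) = trans (weightOf-∷ ω false ⁅ j ⁆) (weightOf-⁅⁆ (ω ∘ suc) j)

_≟ₛ_ : DecidableEquality (Subset n)
_≟ₛ_ = VP.≡-dec Bool._≟_

allSubsets-enumeration : ∀ n → IsEnumeration _≟ₛ_ (allSubsets n)
allSubsets-enumeration = allVecs-enumeration bools
  where
  bools : IsEnumeration Bool._≟_ (true ∷ false ∷ [])
  bools = enumeration λ { true → refl ; false → refl }

-- Colorings whose classes are blocks

withClasses : (Fin m → Subset n) → SetColoring m n
withClasses F = tabulate (λ v → tabulate (λ i → lookup (F i) v))

classOf-withClasses : ∀ (F : Fin m → Subset n) i → classOf (withClasses F) i ≡ F i
classOf-withClasses F i = begin
  tabulate (λ v → lookup (lookup (withClasses F) v) i)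
    ≡⟨ VP.tabulate-cong (λ v → cong (λ row → lookup row i) (VP.lookup∘tabulate _ v)) ⟩
  tabulate (λ v → lookup (tabulate (λ i′ → lookup (F i′) v)) i)
    ≡⟨ VP.tabulate-cong (λ v → VP.lookup∘tabulate _ i) ⟩
  tabulate (lookup (F i))
    ≡⟨ VP.tabulate∘lookup (F i) ⟩
  F i
    ∎

withClasses-classOf : ∀ (κ : SetColoring m n) → withClasses (classOf κ) ≡ κ
withClasses-classOf κ = begin
  tabulate (λ v → tabulate (λ i → lookup (classOf κ i) v))
    ≡⟨ VP.tabulate-cong (λ v → VP.tabulate-cong (λ i → VP.lookup∘tabulate _ v)) ⟩
  tabulate (λ v → tabulate (lookup (lookup κ v)))
    ≡⟨ VP.tabulate-cong (λ v → VP.tabulate∘lookup (lookup κ v)) ⟩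
  tabulate (lookup κ)
    ≡⟨ VP.tabulate∘lookup κ ⟩
  κ
    ∎

withClasses-cong : ∀ {F F′ : Fin m → Subset n} → (∀ i → F i ≡ F′ i) → withClasses F ≡ withClasses F′
withClasses-cong F≗F′ = VP.tabulate-cong (λ v → VP.tabulate-cong (λ i → cong (λ S → lookup S v) (F≗F′ i)))

record IsBlockFamily (D : Fin ℓ → Subset n) : Set where
  field
    injective : ∀ {j j′} → D j ≡ D j′ → j ≡ j′
    nonempty  : ∀ j → Nonempty (D j)

  ≢⊥ : ∀ j → D j ≢ ⊥
  ≢⊥ j Dj≡⊥ = let v , v∈ = nonempty j in ∉⊥ (subst (v ∈ₛ_) Dj≡⊥ v∈)

singletons : IsBlockFamily (⁅_⁆ {ℓ})
singletons = record
  { injective = λ {j} {j′} eq → sym (x∈⁅y⁆⇒x≡y j (subst (j′ ∈ₛ_) (sym eq) (x∈⁅x⁆ j′)))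
  ; nonempty  = λ j → j , x∈⁅x⁆ j
  }

data EmptyOrBlock (D : Fin ℓ → Subset n) : Subset n → Set where
  empty : EmptyOrBlock D ⊥
  block : ∀ j → EmptyOrBlock D (D j)

data Matched (D : Fin ℓ → Subset a) (E : Fin ℓ → Subset b) : Subset a → Subset b → Set where
  empty : Matched D E ⊥ ⊥
  block : ∀ j → Matched D E (D j) (E j)

module _ {D : Fin ℓ → Subset a} {E : Fin ℓ → Subset b} where

  matched-sym : ∀ {S S′} → Matched D E S S′ → Matched E D S′ S
  matched-sym empty     = empty
  matched-sym (block j) = block j

  matched-emptyOrBlock : ∀ {S S′} → Matched D E S S′ → EmptyOrBlock D S
  matched-emptyOrBlock empty     = empty
  matched-emptyOrBlock (block j) = block j

  matched-block : IsBlockFamily D → ∀ {S S′ j} → Matched D E S S′ → S ≡ D j → S′ ≡ E j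
  matched-block D-blocks {j = j} empty      ⊥≡Dj = ⊥-elim (IsBlockFamily.≢⊥ D-blocks j (sym ⊥≡Dj))
  matched-block D-blocks              (block j′) Dj′≡Dj = cong E (IsBlockFamily.injective D-blocks Dj′≡Dj)

  matched-weightOf : ∀ {ω : Fin a → ℕ} {w : Fin b → ℕ} → (∀ j → weightOf ω (D j) ≡ weightOf w (E j)) →
                     ∀ {S S′} → Matched D E S S′ → weightOf ω S ≡ weightOf w S′
  matched-weightOf {ω} {w} _ empty     = trans (weightOf-⊥ ω) (sym (weightOf-⊥ w))
  matched-weightOf         e (block j) = e j

record ClassesMatched (D : Fin ℓ → Subset a) (E : Fin ℓ → Subset b)
                      (κ : SetColoring m a) (τ : SetColoring m b) : Set where
  constructor classesMatched
  field matchedAt : ∀ i → Matched D E (classOf κ i) (classOf τ i)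
open ClassesMatched public

BlocksOccur : (D : Fin ℓ → Subset n) → SetColoring m n → Set
BlocksOccur D κ = ∀ j → ∃ λ i → classOf κ i ≡ D j

module _ {D : Fin ℓ → Subset a} {E : Fin ℓ → Subset b} {κ : SetColoring m a} {τ : SetColoring m b} where

  classesMatched-sym : ClassesMatched D E κ τ → ClassesMatched E D τ κ
  classesMatched-sym matched = classesMatched (matched-sym ∘ matchedAt matched)

  classesMatched-drawn : ClassesMatched D E κ τ → ∀ i → EmptyOrBlock D (classOf κ i)
  classesMatched-drawn matched = matched-emptyOrBlock ∘ matchedAt matched

  blocksOccur-transfer : IsBlockFamily D → ClassesMatched D E κ τ → BlocksOccur D κ → BlocksOccur E τ
  blocksOccur-transfer D-blocks matched occur j =
    let i , eq = occur j in i , matched-block D-blocks (matchedAt matched i) eq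

  monomialIsB-matched : ∀ {ω : Fin a → ℕ} {w : Fin b → ℕ} (α : Fin m → ℕ) →
                        (∀ j → weightOf ω (D j) ≡ weightOf w (E j)) → ClassesMatched D E κ τ →
                        monomialIsB ω α κ ≡ monomialIsB w α τ
  monomialIsB-matched {ω} {w} α weights matched = cong and (LP.map-cong same-exponent (allFin m))
    where
    same-exponent : ∀ i → (exponentOf ω κ i ≡ᵇ α i) ≡ (exponentOf w τ i ≡ᵇ α i)
    same-exponent i = cong (_≡ᵇ α i) (begin
      exponentOf ω κ i             ≡⟨ exponentOf≡weightOf ω κ i ⟩
      weightOf ω (classOf κ i)     ≡⟨ matched-weightOf weights (matchedAt matched i) ⟩
      weightOf w (classOf τ i)     ≡⟨ sym (exponentOf≡weightOf w τ i) ⟩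
      exponentOf w τ i             ∎)

emptyOrBlock-stable : ∀ {G : SimpleGraph n} {D : Fin ℓ → Subset n} → (∀ j → Stable G (D j)) →
                      ∀ {S} → EmptyOrBlock D S → Stable G S
emptyOrBlock-stable _      empty     u∈ _ = ⊥-elim (∉⊥ u∈)
emptyOrBlock-stable stable (block j)      = stable j

proper-fromBlocks : ∀ {G : SimpleGraph n} {D : Fin ℓ → Subset n} {κ : SetColoring m n} →
                    (∀ j → Stable G (D j)) → (∀ v → ∃ λ j → v ∈ₛ D j) →
                    (∀ i → EmptyOrBlock D (classOf κ i)) → BlocksOccur D κ → IsProperColoring G κ
proper-fromBlocks {G = G} stable covers drawn occur = record
  { colored       = λ v → let j , v∈ = covers v
                              i , eq = occur j
                          in i , subst (v ∈ₛ_) (sym eq) v∈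
  ; stableClasses = λ i → emptyOrBlock-stable {G = G} stable (drawn i)
  }

singleton-stable : ∀ (G : SimpleGraph n) v → Stable G ⁅ v ⁆
singleton-stable G v {u} {u′} u∈ u′∈ a with x∈⁅y⁆⇒x≡y v u∈ | x∈⁅y⁆⇒x≡y v u′∈
... | refl | refl = subst T (adjIrr G v) a

stable-complete : ∀ {S : Subset ℓ} → Stable (complete ℓ) S → EmptyOrBlock ⁅_⁆ S
stable-complete {S = S} stable with nonempty? S
... | no  ¬nonempty = subst (EmptyOrBlock ⁅_⁆) (sym (Empty-unique ¬nonempty)) empty
... | yes (j , j∈)  = subst (EmptyOrBlock ⁅_⁆) (⊆-antisym ⁅j⁆⊆S S⊆⁅j⁆) (block j)
  where
  ⁅j⁆⊆S : ∀ {k} → k ∈ₛ ⁅ j ⁆ → k ∈ₛ S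
  ⁅j⁆⊆S k∈ = subst (_∈ₛ S) (sym (x∈⁅y⁆⇒x≡y j k∈)) j∈
  S⊆⁅j⁆ : ∀ {k} → k ∈ₛ S → k ∈ₛ ⁅ j ⁆
  S⊆⁅j⁆ {k} k∈ with k Fin.≟ j
  ... | yes refl = x∈⁅x⁆ k
  ... | no  k≢j  = ⊥-elim (stable k∈ j∈ (distinct⇒adjacent (k Fin.≟ j) k≢j))
    where
    distinct⇒adjacent : ∀ {P : Set} (d : Dec P) → ¬ P → T (not ⌊ d ⌋)
    distinct⇒adjacent (yes p) ¬p = ¬p p
    distinct⇒adjacent (no _)  _  = _

complete-blocksOccur : ∀ {τ : SetColoring m ℓ} → IsProperColoring (complete ℓ) τ → BlocksOccur ⁅_⁆ τ
complete-blocksOccur proper j =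
  let i , j∈ = colored j in i , containing (stable-complete (stableClasses i)) j∈
  where
  open IsProperColoring proper
  containing : ∀ {S} → EmptyOrBlock ⁅_⁆ S → j ∈ₛ S → S ≡ ⁅ j ⁆
  containing empty      j∈ = ⊥-elim (∉⊥ j∈)
  containing (block j′) j∈ = cong ⁅_⁆ (sym (x∈⁅y⁆⇒x≡y j′ j∈))

module Relabelling (c : Fin ℓ → Subset n) (c-blocks : IsBlockFamily c) where
  open IsBlockFamily c-blocks

  relabel : Subset n → Subset ℓ
  relabel S = tabulate (λ j → ⌊ S ≟ₛ c j ⌋)

  merge : Subset ℓ → Subset n
  merge J = tabulate (λ v → any (λ j → lookup J j ∧ lookup (c j) v) (allFin ℓ))

  ∈-relabel⇔ : ∀ {S j} → j ∈ₛ relabel S ⇔ (S ≡ c j)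
  ∈-relabel⇔ = mk⇔ (toWitness ∘ to ∈-tabulate⇔) (from ∈-tabulate⇔ ∘ fromWitness)

  ∈-merge⇔ : ∀ {J v} → v ∈ₛ merge J ⇔ ∃ λ j → j ∈ₛ J × v ∈ₛ c j
  ∈-merge⇔ {J} {v} = mk⇔
    (λ v∈ → let j , both = to (T-any-allFin _) (to ∈-tabulate⇔ v∈)
                j∈ , v∈c = to T-∧ both
            in j , from ∈ₛ⇔T j∈ , from ∈ₛ⇔T v∈c)
    (λ (j , j∈ , v∈c) → from ∈-tabulate⇔ (from (T-any-allFin (λ j → lookup J j ∧ lookup (c j) v))
                                                 (j , from T-∧ (to ∈ₛ⇔T j∈ , to ∈ₛ⇔T v∈c))))

  relabel-block : ∀ j → relabel (c j) ≡ ⁅ j ⁆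
  relabel-block j = ⊆-antisym
    (λ {k} k∈ → subst (_∈ₛ ⁅ j ⁆) (injective (to ∈-relabel⇔ k∈)) (x∈⁅x⁆ j))
    (λ {k} k∈ → from ∈-relabel⇔ (cong c (sym (x∈⁅y⁆⇒x≡y j k∈))))

  relabel-⊥ : relabel ⊥ ≡ ⊥
  relabel-⊥ = ⊆-antisym (λ {k} k∈ → ⊥-elim (≢⊥ k (sym (to ∈-relabel⇔ k∈)))) ⊥⊆

  merge-⁅⁆ : ∀ j → merge ⁅ j ⁆ ≡ c j
  merge-⁅⁆ j = ⊆-antisym
    (λ v∈ → let k , k∈ , v∈c = to ∈-merge⇔ v∈ in subst (λ k → _ ∈ₛ c k) (x∈⁅y⁆⇒x≡y j k∈) v∈c)
    (λ v∈c → from ∈-merge⇔ (j , x∈⁅x⁆ j , v∈c))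

  merge-⊥ : merge ⊥ ≡ ⊥
  merge-⊥ = ⊆-antisym (λ v∈ → let _ , k∈⊥ , _ = to ∈-merge⇔ v∈ in ⊥-elim (∉⊥ k∈⊥)) ⊥⊆

  relabel-matched : ∀ {S S′} → Matched c ⁅_⁆ S S′ → relabel S ≡ S′
  relabel-matched empty     = relabel-⊥
  relabel-matched (block j) = relabel-block j

  merge-matched : ∀ {S S′} → Matched c ⁅_⁆ S S′ → merge S′ ≡ S
  merge-matched empty     = merge-⊥
  merge-matched (block j) = merge-⁅⁆ j

  matched-relabel : ∀ {S} → EmptyOrBlock c S → Matched c ⁅_⁆ S (relabel S)
  matched-relabel empty     = subst (Matched c ⁅_⁆ ⊥) (sym relabel-⊥) empty
  matched-relabel (block j) = subst (Matched c ⁅_⁆ (c j)) (sym (relabel-block j)) (block j)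

  matched-merge : ∀ {S′} → EmptyOrBlock ⁅_⁆ S′ → Matched c ⁅_⁆ (merge S′) S′
  matched-merge empty     = subst (λ S → Matched c ⁅_⁆ S ⊥) (sym merge-⊥) empty
  matched-merge (block j) = subst (λ S → Matched c ⁅_⁆ S ⁅ j ⁆) (sym (merge-⁅⁆ j)) (block j)

  -- collapse gives block j the colors whose class is c j;
  -- expand gives each vertex the colors of the blocks containing it.
  collapse : SetColoring m n → SetColoring m ℓ
  collapse κ = withClasses (relabel ∘ classOf κ)

  expand : SetColoring m ℓ → SetColoring m n
  expand τ = withClasses (merge ∘ classOf τ)

  collapse-matched : ∀ {κ : SetColoring m n} → (∀ i → EmptyOrBlock c (classOf κ i)) →
                     ClassesMatched c ⁅_⁆ κ (collapse κ)
  collapse-matched {κ = κ} drawn = classesMatched λ i →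
    subst (Matched c ⁅_⁆ (classOf κ i)) (sym (classOf-withClasses (relabel ∘ classOf κ) i))
          (matched-relabel (drawn i))

  expand-matched : ∀ {τ : SetColoring m ℓ} → (∀ i → EmptyOrBlock ⁅_⁆ (classOf τ i)) →
                   ClassesMatched c ⁅_⁆ (expand τ) τ
  expand-matched {τ = τ} drawn = classesMatched λ i →
    subst (λ S → Matched c ⁅_⁆ S (classOf τ i)) (sym (classOf-withClasses (merge ∘ classOf τ) i))
          (matched-merge (drawn i))

  collapse-unique : ∀ {κ : SetColoring m n} {τ} → ClassesMatched c ⁅_⁆ κ τ → collapse κ ≡ τ
  collapse-unique {κ = κ} {τ} matched =
    trans (withClasses-cong {F = relabel ∘ classOf κ} (relabel-matched ∘ matchedAt matched)) (withClasses-classOf τ)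

  expand-unique : ∀ {κ : SetColoring m n} {τ} → ClassesMatched c ⁅_⁆ κ τ → expand τ ≡ κ
  expand-unique {κ = κ} {τ} matched =
    trans (withClasses-cong {F = merge ∘ classOf τ} (merge-matched ∘ matchedAt matched)) (withClasses-classOf κ)

-- The stable set cover of a coloring

_≟C_ : DecidableEquality (List (Subset n))
_≟C_ = LP.≡-dec _≟ₛ_

isNonemptyClassB : SetColoring m n → Subset n → Bool
isNonemptyClassB κ S = nonemptyB S ∧ any (λ i → ⌊ classOf κ i ≟ₛ S ⌋) (allFin _)

-- Listed in the order of allSubsets, like the members of SSC G, so that it can be compared with them by ≡.
coverOf : SetColoring m n → List (Subset n)
coverOf κ = L.filterᵇ (isNonemptyClassB κ) (allSubsets _)

allSubsets-distinct : ∀ n → Distinct _≟ₛ_ (allSubsets n)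
allSubsets-distinct n = enumeration⇒distinct _≟ₛ_ (allSubsets-enumeration n)

module _ {κ : SetColoring m n} where

  IsNonemptyClass : Subset n → Set
  IsNonemptyClass S = Nonempty S × ∃ λ i → classOf κ i ≡ S

  isNonemptyClass⇔ : ∀ {S} → T (isNonemptyClassB κ S) ⇔ IsNonemptyClass S
  isNonemptyClass⇔ {S} = mk⇔
    (λ t → let ne , cl = to T-∧ t
               i , eq  = to (T-any-allFin isS) cl
           in to nonemptyB⇔ ne , i , toWitness eq)
    (λ (ne , i , eq) → from T-∧ (from nonemptyB⇔ ne , from (T-any-allFin isS) (i , fromWitness eq)))
    where
    isS : Fin m → Bool
    isS i = ⌊ classOf κ i ≟ₛ S ⌋

  ∈-coverOf⇔ : ∀ {S} → S ∈ coverOf κ ⇔ IsNonemptyClass S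
  ∈-coverOf⇔ = mk⇔
    (to isNonemptyClass⇔ ∘ proj₂ ∘ ∈-filter⁻ (T? ∘ isNonemptyClassB κ) {xs = allSubsets n})
    (λ good → ∈-filter⁺ (T? ∘ isNonemptyClassB κ) (enumeration-∈ _≟ₛ_ (allSubsets-enumeration n) _)
                        (from isNonemptyClass⇔ good))

  coverOf-≡ : ∀ {C} → C ∈ sublists (allSubsets n) → (∀ {S} → S ∈ C ⇔ IsNonemptyClass S) →
              coverOf κ ≡ C
  coverOf-≡ C-sub C⇔ = filterᵇ-≡-sublist (isNonemptyClassB κ) (allSubsets-distinct n) C-sub
    (λ _ good → from C⇔ (to isNonemptyClass⇔ good)) (from isNonemptyClass⇔ ∘ to C⇔)

  coverOf-isStableSetCover : ∀ {G} → IsProperColoring G κ → IsStableSetCover G (coverOf κ)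
  coverOf-isStableSetCover {G} proper = record
    { nonempty = proj₁ ∘ to ∈-coverOf⇔
    ; stable   = λ S∈ → let _ , i , eq = to ∈-coverOf⇔ S∈ in subst (Stable G) eq (stableClasses i)
    ; covers   = λ v → let i , v∈ = colored v in classOf κ i , from ∈-coverOf⇔ ((v , v∈) , i , refl) , v∈
    }
    where open IsProperColoring proper

  coverOf-once-in-SSC : ∀ {G} → IsProperColoring G κ → multiplicity _≟C_ (coverOf κ) (SSC G) ≡ 1
  coverOf-once-in-SSC {G} proper = begin
    count (λ C → ⌊ coverOf κ ≟C C ⌋) (L.filterᵇ (isSSCB G) (sublists (allSubsets n)))
      ≡⟨ count-filterᵇ (isSSCB G) _ (sublists (allSubsets n)) ⟩
    count (λ C → isSSCB G C ∧ ⌊ coverOf κ ≟C C ⌋) (sublists (allSubsets n))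
      ≡⟨ count-cong (sublists (allSubsets n)) (λ C → T-ext (proj₂ ∘ to T-∧) (only-cover C)) ⟩
    multiplicity _≟C_ (coverOf κ) (sublists (allSubsets n))
      ≡⟨ sublists-once (allSubsets-distinct n) (filterᵇ-∈-sublists (isNonemptyClassB κ) (allSubsets n)) ⟩
    1 ∎
    where
    only-cover : ∀ C → T ⌊ coverOf κ ≟C C ⌋ → T (isSSCB G C ∧ ⌊ coverOf κ ≟C C ⌋)
    only-cover C t with toWitness t
    ... | refl = from T-∧ (from isSSCB⇔ (coverOf-isStableSetCover proper) , t)

module _ {G : SimpleGraph n} {C} (C∈ : C ∈ SSC G) where

  SSC-sublist : C ∈ sublists (allSubsets n)
  SSC-sublist = proj₁ (∈-filter⁻ (T? ∘ isSSCB G) {xs = sublists (allSubsets n)} C∈)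

  SSC-isStableSetCover : IsStableSetCover G C
  SSC-isStableSetCover = to isSSCB⇔ (proj₂ (∈-filter⁻ (T? ∘ isSSCB G) {xs = sublists (allSubsets n)} C∈))

record Indexing {A : Set} (C : List A) (ℓ : ℕ) : Set where
  field
    entry     : Fin ℓ → A
    injective : ∀ {j j′} → entry j ≡ entry j′ → j ≡ j′
    ∈⇔        : ∀ {a} → a ∈ C ⇔ ∃ λ j → entry j ≡ a

module FibreOverCover (G : SimpleGraph n) (ω : Fin n → ℕ) (α : Fin m → ℕ)
                      {C} (C∈ : C ∈ SSC G) {ℓ} (I : Indexing C ℓ)
                      (w : Fin ℓ → ℕ) (w≡ : ∀ j → w j ≡ weightOf ω (Indexing.entry I j)) where

  open Indexing I renaming (entry to c)

  open IsStableSetCover (SSC-isStableSetCover {G = G} C∈)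

  c-blocks : IsBlockFamily c
  c-blocks = record { injective = injective ; nonempty = λ j → nonempty (from ∈⇔ (j , refl)) }

  open Relabelling c c-blocks

  weights : ∀ j → weightOf ω (c j) ≡ weightOf w ⁅ j ⁆
  weights j = trans (sym (w≡ j)) (sym (weightOf-⁅⁆ w j))

  module _ {κ : SetColoring m n} where

    coverOf-≡-C⇒ : coverOf κ ≡ C → (∀ i → EmptyOrBlock c (classOf κ i)) × BlocksOccur c κ
    coverOf-≡-C⇒ refl = drawn , occur
      where
      drawn : ∀ i → EmptyOrBlock c (classOf κ i)
      drawn i with nonempty? (classOf κ i)
      ... | no  ¬ne = subst (EmptyOrBlock c) (sym (Empty-unique ¬ne)) empty
      ... | yes ne  = let j , eq = to ∈⇔ (from (∈-coverOf⇔ {κ = κ}) (ne , i , refl))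
                      in subst (EmptyOrBlock c) eq (block j)
      occur : BlocksOccur c κ
      occur j = proj₂ (to (∈-coverOf⇔ {κ = κ}) (from ∈⇔ (j , refl)))

    coverOf-≡-C⇐ : (∀ i → EmptyOrBlock c (classOf κ i)) → BlocksOccur c κ → coverOf κ ≡ C
    coverOf-≡-C⇐ drawn occur = coverOf-≡ {κ = κ} (SSC-sublist {G = G} C∈) (mk⇔ block⇒class class⇒block)
      where
      block⇒class : ∀ {S} → S ∈ C → IsNonemptyClass {κ = κ} S
      block⇒class S∈ with to ∈⇔ S∈
      ... | j , refl = nonempty S∈ , occur j
      nonemptyBlock∈C : ∀ {S} → EmptyOrBlock c S → Nonempty S → S ∈ C
      nonemptyBlock∈C empty     (_ , v∈⊥) = ⊥-elim (∉⊥ v∈⊥)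
      nonemptyBlock∈C (block j) _         = from ∈⇔ (j , refl)
      class⇒block : ∀ {S} → IsNonemptyClass {κ = κ} S → S ∈ C
      class⇒block (ne , i , refl) = nonemptyBlock∈C (drawn i) ne

  inFibre? : SetColoring m n → Bool
  inFibre? κ = (properB G κ ∧ monomialIsB ω α κ) ∧ ⌊ coverOf κ ≟C C ⌋

  kromatic? : SetColoring m ℓ → Bool
  kromatic? τ = properB (complete ℓ) τ ∧ monomialIsB w α τ

  inFibre⇔ : ∀ {κ} → T (inFibre? κ) ⇔ (IsProperColoring G κ × T (monomialIsB ω α κ) × coverOf κ ≡ C)
  inFibre⇔ {κ} = mk⇔
    (λ t → let pm , cov = to (T-∧ {properB G κ ∧ monomialIsB ω α κ}) t
               p , mono = to (T-∧ {properB G κ}) pm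
           in to properB⇔ p , mono , toWitness cov)
    (λ (p , mono , cov) → from T-∧ (from T-∧ (from properB⇔ p , mono) , fromWitness cov))

  kromatic⇔ : ∀ {τ} → T (kromatic? τ) ⇔ (IsProperColoring (complete ℓ) τ × T (monomialIsB w α τ))
  kromatic⇔ {τ} = mk⇔ (λ t → let p , mono = to (T-∧ {properB (complete ℓ) τ}) t in to properB⇔ p , mono)
                      (λ (p , mono) → from T-∧ (from properB⇔ p , mono))

  module _ {κ : SetColoring m n} (t : T (inFibre? κ)) where

    private
      drawn×occur : (∀ i → EmptyOrBlock c (classOf κ i)) × BlocksOccur c κ
      drawn×occur = coverOf-≡-C⇒ {κ = κ} (proj₂ (proj₂ (to (inFibre⇔ {κ}) t)))

    collapse-matched′ : ClassesMatched c ⁅_⁆ κ (collapse κ)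
    collapse-matched′ = collapse-matched (proj₁ drawn×occur)

    collapse-kromatic : T (kromatic? (collapse κ))
    collapse-kromatic = from (kromatic⇔ {collapse κ})
      ( proper-fromBlocks (singleton-stable (complete ℓ)) (λ j → j , x∈⁅x⁆ j)
                          (classesMatched-drawn (classesMatched-sym collapse-matched′))
                          (blocksOccur-transfer c-blocks collapse-matched′ (proj₂ drawn×occur))
      , subst T (monomialIsB-matched α weights collapse-matched′) (proj₁ (proj₂ (to (inFibre⇔ {κ}) t))))

  module _ {τ : SetColoring m ℓ} (t : T (kromatic? τ)) where

    private
      proper = proj₁ (to (kromatic⇔ {τ}) t)

    expand-matched′ : ClassesMatched c ⁅_⁆ (expand τ) τ
    expand-matched′ = expand-matched (stable-complete ∘ IsProperColoring.stableClasses proper)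

    expand-inFibre : T (inFibre? (expand τ))
    expand-inFibre = from (inFibre⇔ {expand τ})
      ( proper-fromBlocks block-stable blocks-cover drawn occur
      , subst T (sym (monomialIsB-matched α weights expand-matched′)) (proj₂ (to (kromatic⇔ {τ}) t))
      , coverOf-≡-C⇐ {κ = expand τ} drawn occur)
      where
      drawn = classesMatched-drawn expand-matched′
      occur = blocksOccur-transfer singletons (classesMatched-sym expand-matched′) (complete-blocksOccur proper)
      block-stable : ∀ j → Stable G (c j)
      block-stable j = stable (from ∈⇔ (j , refl))
      blocks-cover : ∀ v → ∃ λ j → v ∈ₛ c j
      blocks-cover v = let S , S∈ , v∈ = covers v
                           j , eq      = to ∈⇔ S∈
                       in j , subst (v ∈ₛ_) (sym eq) v∈

  fibre-count : count inFibre? (allVecs (allSubsets m) n) ≡ kromaticCoeff (complete ℓ) w α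
  fibre-count = count-bijection (allVecs-enumeration (allSubsets-enumeration m) n)
                                (allVecs-enumeration (allSubsets-enumeration m) ℓ)
                                collapse expand
                                (λ κ → collapse-kromatic {κ}) (λ τ → expand-inFibre {τ})
                                (λ κ → expand-unique ∘ collapse-matched′ {κ})
                                (λ τ → collapse-unique ∘ expand-matched′ {τ})

-- Listing a cover in the order of its partition

-- Indexed by the positions of map h C, which avoids casting between Fin (length (map h C)) and Fin (length C).
entryAt : (h : A → B) (C : List A) → Fin (length (map h C)) → A
entryAt h (x ∷ C) zero    = x
entryAt h (x ∷ C) (suc k) = entryAt h C k

module _ (h : A → B) where

  lookup-map-entryAt : ∀ C k → L.lookup (map h C) k ≡ h (entryAt h C k)
  lookup-map-entryAt (x ∷ C) zero    = refl
  lookup-map-entryAt (x ∷ C) (suc k) = lookup-map-entryAt C k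

  entryAt-∈ : ∀ C k → entryAt h C k ∈ C
  entryAt-∈ (x ∷ C) zero    = here refl
  entryAt-∈ (x ∷ C) (suc k) = there (entryAt-∈ C k)

  entryAt-surjective : ∀ {C x} → x ∈ C → ∃ λ k → entryAt h C k ≡ x
  entryAt-surjective (here refl) = zero , refl
  entryAt-surjective (there x∈)  = let k , eq = entryAt-surjective x∈ in suc k , eq

  entryAt-injective : ∀ {_≟_ : DecidableEquality A} {C} → Distinct _≟_ C →
                      ∀ {k k′} → entryAt h C k ≡ entryAt h C k′ → k ≡ k′
  entryAt-injective {_≟_} {x ∷ C} d {zero}  {zero}   _  = refl
  entryAt-injective {_≟_} {x ∷ C} d {zero}  {suc k′} eq =
    ⊥-elim (distinct-head _≟_ d (subst (_∈ C) (sym eq) (entryAt-∈ C k′)))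
  entryAt-injective {_≟_} {x ∷ C} d {suc k} {zero}   eq =
    ⊥-elim (distinct-head _≟_ d (subst (_∈ C) eq (entryAt-∈ C k)))
  entryAt-injective {_≟_} {x ∷ C} d {suc k} {suc k′} eq = cong suc (entryAt-injective (distinct-tail _≟_ d) eq)

module ↭-Indexing {_≟_ : DecidableEquality A} {C : List A} (C-distinct : Distinct _≟_ C)
                  (h : A → ℕ) {ps : List ℕ} (ps↭ : ps ↭ map h C) where

  private
    σ = Permₛ.onIndices (↭⇒↭ₛ ps↭)

  indexing : Indexing C (length ps)
  indexing = record
    { entry     = entryAt h C ∘ Inverse.to σ
    ; injective = λ eq → trans (sym (Permutation.inverseˡ σ))
                           (trans (cong (Inverse.from σ) (entryAt-injective h C-distinct eq))
                                  (Permutation.inverseˡ σ))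
    ; ∈⇔        = mk⇔ (λ x∈ → let k , eq = entryAt-surjective h x∈
                                in Inverse.from σ k , trans (cong (entryAt h C) (Permutation.inverseʳ σ)) eq)
                      (λ (j , eq) → subst (_∈ C) eq (entryAt-∈ h C (Inverse.to σ j)))
    }

  lookup-indexing : ∀ j → L.lookup ps j ≡ h (Indexing.entry indexing j)
  lookup-indexing j = trans (Permₛ.onIndices-lookup (setoid ℕ) (↭⇒↭ₛ ps↭) j)
                            (lookup-map-entryAt h C (Inverse.to σ j))

partitionOf-↭ : ∀ (ω : Fin n → ℕ) C → partitionOf ω C ↭ map (weightOf ω) C
partitionOf-↭ ω C = ↭-trans (↭-reverse (sort (map (weightOf ω) C))) (sort-↭ (map (weightOf ω) C))

proposition3p4 : ∀ {n} (G : SimpleGraph n) (ω : Fin n → ℕ) → (∀ v → 1 ≤ ω v) →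
    ∀ {m} (α : Fin m → ℕ) →
    kromaticCoeff G ω α ≡ sum (map (λ C → augMonCoeff (partitionOf ω C) α) (SSC G))
proposition3p4 {n} G ω _ {m} α = begin
  count counted? (allVecs (allSubsets m) n)
    ≡⟨ count-fibres _≟C_ coverOf counted? (allVecs (allSubsets m) n) (SSC G) coverOnce ⟩
  ∑[ C ← SSC G ] count (λ κ → counted? κ ∧ ⌊ coverOf κ ≟C C ⌋) (allVecs (allSubsets m) n)
    ≡⟨ ∑-cong (SSC G) fibre ⟩
  ∑[ C ← SSC G ] augMonCoeff (partitionOf ω C) α ∎
  where
  counted? : SetColoring m n → Bool
  counted? κ = properB G κ ∧ monomialIsB ω α κ

  coverOnce : ∀ κ → T (counted? κ) → multiplicity _≟C_ (coverOf κ) (SSC G) ≡ 1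
  coverOnce κ t = coverOf-once-in-SSC (to (properB⇔ {G = G} {κ = κ}) (proj₁ (to (T-∧ {properB G κ}) t)))

  fibre : ∀ {C} → C ∈ SSC G → count (λ κ → counted? κ ∧ ⌊ coverOf κ ≟C C ⌋) (allVecs (allSubsets m) n)
                              ≡ augMonCoeff (partitionOf ω C) α
  fibre {C} C∈ = FibreOverCover.fibre-count G ω α C∈ indexing (L.lookup (partitionOf ω C)) lookup-indexing
    where
    open ↭-Indexing (distinct-sublist (allSubsets-distinct n) (SSC-sublist {G = G} C∈))
                    (weightOf ω) (partitionOf-↭ ω C)
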